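{- Let $T$ be a tree and $L\subseteq V$. Suppose that for every core $v$ of $T$, the set of vertices of $L$ lying on the g-legs of $v$ is a local set of $v$. Then for every core $v$ and every pair of distinct vertices $x,y\notin L$ lying on g-legs of $v$ with equal positions (i.e. $d(x,v)=d(y,v)$), there are at least two vertices of $L$ that separate $x$ and $y$.
   Context: Let $T=(V,E)$ be a finite tree and $d(x,y)$ the number of edges on the path between $x$ and $y$. A vertex $\tau$ separates $u$ and $w$ if $d(u,\tau)\neq d(w,\tau)$. A core is a vertex of degree at least $3$. For a vertex $v$, the subtrees of the neighbors of $v$ are the connected components of $T-v$. A (standard) leg of a core $v$ is a subtree of a neighbor of $v$ containing no core (a path attached to $v$); it is short if it has one vertex and long otherwise. For a leg $\ell$ of $v$, $\ell^i$ denotes the vertex of $\ell$ at distance $i$ from $v$ (its position is $i$). A small core is a core of degree exactly $3$ with at least two legs, at least one of which is short; other cores are regular. A modified leg of a core $v$ is a subtree of a neighbor of $v$ containing exactly one core, which is a small core $w$; the position of a vertex on it is its distance from $v$; if $w$ has position $i$, the two vertices of position $i+1$ are $\ell^a,\ell^b$, where $\ell^b$ is the vertex of a short leg of $w$ (chosen arbitrarily if both legs of $w$ inside $\ell$ are short). A g-leg of $v$ is a standard leg or a modified leg of $v$. Solution types. For a set $S$ and a standard leg $\ell$, $S\cap\ell$ is of type $(s,0)$ if empty; $(s,1)$ if it is a single vertex of position at least $2$; $(s,2)$ if it has at least two vertices; $(s,3)$ if it equals $\{\ell^1\}$. For a modified leg $\ell$ whose small core has position $i$: type $(m,1)$ if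 $S\cap\ell$ equals $\{\ell^a\}$ or $\{\ell^b\}$; type $(m,2)$ if it contains neither $\ell^a$ nor $\ell^b$ and contains at least two vertices of position at least $i+2$; type $(m,3)$ if it has at least two vertices, at least one of which is $\ell^a$ or $\ell^b$. A local set of a core $v$ is a set $S$ of vertices of the g-legs of $v$ (so $v\notin S$) such that: (1) at most one standard leg has type $(s,0)$ and all other standard legs have type $(s,1)$, $(s,2)$ or $(s,3)$; (2) every modified leg has type $(m,1)$, $(m,2)$ or $(m,3)$; (3) if some standard leg has type $(s,0)$ then no modified leg has type $(m,1)$; (4) if some long leg $\ell$ has type $(s,0)$ then every long leg other than $\ell$ has type $(s,2)$; (5) if some short leg has type $(s,0)$ then every long leg has type $(s,2)$ or $(s,3)$. -}

module Defs where

open import Data.Nat using (ℕ; zero; suc; _≤_; _<_)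
open import Data.Fin using (Fin)
open import Data.Bool using (Bool; true; false; if_then_else_)
open import Data.List using (List; []; _∷_; length; map; allFin)
open import Data.Nat.ListAction using (sum)
open import Data.List.Relation.Unary.All using (All)
open import Data.List.Relation.Unary.Unique.Propositional using (Unique)
open import Data.Product using (Σ; ∃; ∃-syntax; _×_; _,_)
open import Data.Sum using (_⊎_)
open import Relation.Binary.PropositionalEquality using (_≡_; _≢_)
open import Relation.Nullary using (¬_)

module Graph {n : ℕ} (adj : Fin n → Fin n → Bool) where

  Edge : Fin n → Fin n → Set
  Edge x y = adj x y ≡ true

  data Walk : Fin n → Fin n → List (Fin n) → Set where
    here : ∀ {x} → Walk x x (x ∷ [])
    step : ∀ {x y z vs} → Edge x y → Walk y z vs → Walk x z (x ∷ vs)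

  IsPath : Fin n → Fin n → List (Fin n) → Set
  IsPath x y vs = Walk x y vs × Unique vs

  IsTree : Set
  IsTree = (∀ x y → adj x y ≡ adj y x)
         × (∀ x → adj x x ≡ false)
         × (∀ x y → ∃[ vs ] IsPath x y vs)
         × (∀ x y vs ws → IsPath x y vs → IsPath x y ws → vs ≡ ws)

  Dist : Fin n → Fin n → ℕ → Set
  Dist x y k = ∃[ vs ] (IsPath x y vs × length vs ≡ suc k)

  Separates : Fin n → Fin n → Fin n → Set
  Separates τ u w = ∃[ k₁ ] ∃[ k₂ ] (Dist u τ k₁ × Dist w τ k₂ × k₁ ≢ k₂)

  deg : Fin n → ℕ
  deg v = sum (map (λ u → if adj v u then 1 else 0) (allFin n))

  Core : Fin n → Set
  Core v = 3 ≤ deg v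

  -- x lies in the subtree of the neighbour u of v, i.e. the component of T - v
  -- containing u (u is assumed adjacent to v where used).
  InComp : Fin n → Fin n → Fin n → Set
  InComp v u x = ∃[ vs ] (Walk u x vs × All (_≢ v) vs)

  Leg : Fin n → Fin n → Set
  Leg v u = Edge v u × (∀ x → InComp v u x → deg x < 3)

  Short : Fin n → Fin n → Set
  Short v u = ∀ x → InComp v u x → x ≡ u

  Long : Fin n → Fin n → Set
  Long v u = ¬ Short v u

  SmallCore : Fin n → Set
  SmallCore w = deg w ≡ 3
    × ∃[ u₁ ] ∃[ u₂ ] (u₁ ≢ u₂ × Leg w u₁ × Leg w u₂ × (Short w u₁ ⊎ Short w u₂))

  ModLegAt : Fin n → Fin n → Fin n → Set
  ModLegAt v u w = Edge v u × InComp v u w × SmallCore w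
    × (∀ x → InComp v u x → Core x → x ≡ w)

  ModLeg : Fin n → Fin n → Set
  ModLeg v u = ∃[ w ] ModLegAt v u w

  GLeg : Fin n → Fin n → Set
  GLeg v u = Leg v u ⊎ ModLeg v u

  OnGLeg : Fin n → Fin n → Set
  OnGLeg v x = ∃[ u ] (GLeg v u × InComp v u x)

  VSet : Set₁
  VSet = Fin n → Set

  module Types (v : Fin n) (S : VSet) where
    -- standard leg types (leg given by neighbour u of v; ℓ¹ = u)
    TypeS0 : Fin n → Set
    TypeS0 u = ∀ x → InComp v u x → ¬ S x

    TypeS1 : Fin n → Set
    TypeS1 u = ∃[ x ] (InComp v u x × S x
                 × (∃[ k ] (Dist v x k × 2 ≤ k))
                 × (∀ y → InComp v u y → S y → y ≡ x))

    TwoIn : Fin n → Set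
    TwoIn u = ∃[ x ] ∃[ y ] (x ≢ y × InComp v u x × InComp v u y × S x × S y)

    TypeS2 : Fin n → Set
    TypeS2 u = TwoIn u

    TypeS3 : Fin n → Set
    TypeS3 u = S u × (∀ y → InComp v u y → S y → y ≡ u)

    -- ℓᵃ / ℓᵇ : the vertices of the modified leg at position i+1,
    -- where i is the position of the small core w.
    AB : Fin n → Fin n → Set
    AB w x = ∃[ i ] (Dist v w i × Dist v x (suc i))

    TypeM1 : Fin n → Fin n → Set
    TypeM1 u w = ∃[ x ] (InComp v u x × AB w x × S x
                   × (∀ y → InComp v u y → S y → y ≡ x))

    TypeM2 : Fin n → Fin n → Set
    TypeM2 u w = (∀ x → InComp v u x → AB w x → ¬ S x)
      × ∃[ i ] (Dist v w i × ∃[ x ] ∃[ y ] (x ≢ y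
          × InComp v u x × InComp v u y × S x × S y
          × (∃[ k ] (Dist v x k × suc (suc i) ≤ k))
          × (∃[ k ] (Dist v y k × suc (suc i) ≤ k))))

    TypeM3 : Fin n → Fin n → Set
    TypeM3 u w = TwoIn u × ∃[ x ] (InComp v u x × AB w x × S x)

  LocalSet : Fin n → VSet → Set
  LocalSet v S =
      (∀ x → S x → OnGLeg v x)
    × (∀ u₁ u₂ → Leg v u₁ → Leg v u₂ → TypeS0 u₁ → TypeS0 u₂ → u₁ ≡ u₂)
    × (∀ u → Leg v u → TypeS0 u ⊎ TypeS1 u ⊎ TypeS2 u ⊎ TypeS3 u)
    × (∀ u w → ModLegAt v u w → TypeM1 u w ⊎ TypeM2 u w ⊎ TypeM3 u w)
    × ((∃[ u ] (Leg v u × TypeS0 u)) → ∀ u w → ModLegAt v u w → ¬ TypeM1 u w)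
    × (∀ u → Leg v u → Long v u → TypeS0 u →
         ∀ u′ → Leg v u′ → Long v u′ → u′ ≢ u → TypeS2 u′)
    × (∀ u → Leg v u → Short v u → TypeS0 u →
         ∀ u′ → Leg v u′ → Long v u′ → TypeS2 u′ ⊎ TypeS3 u′)
    where open Types v S

-- Root T at v.  The path from v to x starts v, uˣ for the neighbour uˣ whose g-leg
-- contains x; likewise for y.
--  * uˣ ≠ uʸ: every vertex of the leg of uˣ is strictly closer to x than to y, and vice
--    versa (separates-across).  So it suffices that the two legs together contain two
--    L-vertices, which conditions (1)–(5) of a local set guarantee when x, y ∉ L (across-legs).
--  * uˣ = uʸ: the paths to x and y branch at a vertex of degree ≥ 3 of the leg (branch-core),
--    so the leg is a modified leg whose small core w is the branch vertex.  One child of w is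
--    a short leg, hence x, y are the two children ℓᵃ, ℓᵇ of w.  As these are not in L, the leg
--    has type (m,2); its two L-vertices lie below ℓᵃ or ℓᵇ and so separate them (within-leg).
module Submission where

open import Defs
open import Data.Nat using (ℕ; suc; _+_; _≤_; _<_; z≤n; s≤s)
import Data.Nat.Properties as ℕP
open import Data.Fin using (Fin)
open import Data.Bool using (Bool; true; if_then_else_)
import Data.Bool.Properties as BoolP
import Data.Fin.Properties as FinP
open import Data.Nat.ListAction using (sum)
open import Data.Nat.ListAction.Properties using (sum-↭)
import Data.List.Relation.Binary.Permutation.Propositional.Properties as PermProp
open import Data.List using (List; []; _∷_; _++_; length; map; reverse; [_]; allFin)
import Data.List.Properties as ListP
open import Data.List.Relation.Unary.All as All using (All; []; _∷_)
import Data.List.Relation.Unary.All.Properties as AllP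
open import Data.List.Relation.Unary.Any using (here; there)
import Data.List.Relation.Unary.Any.Properties as AnyP
open import Data.List.Relation.Unary.AllPairs using ([]; _∷_)
open import Data.List.Relation.Unary.Unique.Propositional using (Unique)
import Data.List.Relation.Unary.Unique.Propositional.Properties as UniqueP
import Data.List.Relation.Binary.Permutation.Setoid as Perm
import Data.List.Relation.Binary.Permutation.Setoid.Properties as PermP
open import Data.List.Membership.Propositional using (_∈_)
import Data.List.Membership.Propositional.Properties as MemP
open import Data.Product using (∃-syntax; _×_; _,_; proj₁; proj₂)
open import Data.Sum using (_⊎_; inj₁; inj₂)
open import Data.Empty using (⊥; ⊥-elim)
open import Data.Unit using (⊤; tt)
open import Relation.Binary.PropositionalEquality
  using (_≡_; _≢_; refl; sym; trans; cong; subst; setoid; ≢-sym; module ≡-Reasoning)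
open import Relation.Nullary using (¬_; Dec; yes; no; ¬?; _×-dec_)

module _ {A : Set} where

  Unique-++⁻ : ∀ (X : List A) {Y} → Unique (X ++ Y) →
    Unique X × Unique Y × (∀ {z} → z ∈ X → z ∈ Y → ⊥)
  Unique-++⁻ [] u = [] , u , λ ()
  Unique-++⁻ (x ∷ X) (x∉ ∷ u) with Unique-++⁻ X u
  ... | uX , uY , disjoint = (AllP.++⁻ˡ X x∉ ∷ uX) , uY , disjoint′
    where
    disjoint′ : ∀ {z} → z ∈ x ∷ X → z ∈ _ → ⊥
    disjoint′ (here refl) zY = All.lookup (AllP.++⁻ʳ X x∉) zY refl
    disjoint′ (there zX) zY = disjoint zX zY

  Unique-suffix : ∀ (X : List A) {Y} → Unique (X ++ Y) → Unique Y
  Unique-suffix X u = proj₁ (proj₂ (Unique-++⁻ X u))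

  Unique-reverse : ∀ {X : List A} → Unique X → Unique (reverse X)
  Unique-reverse {X} =
    PermP.Unique-resp-↭ (setoid A) (Perm.↭-sym (setoid A) (PermP.↭-reverse (setoid A) X))

  split-last : ∀ (c : A) C → ∃[ C₀ ] ∃[ m ] (c ∷ C ≡ C₀ ++ [ m ])
  split-last c [] = [] , c , refl
  split-last c (d ∷ C) with split-last d C
  ... | C₀ , m , eq = c ∷ C₀ , m , cong (c ∷_) eq

  split-last₂ : ∀ (a b : A) C → ∃[ D ] ∃[ p ] ∃[ m ] (a ∷ b ∷ C ≡ D ++ p ∷ m ∷ [])
  split-last₂ a b [] = [] , a , b , refl
  split-last₂ a b (c ∷ C) with split-last₂ b c C
  ... | D , p , m , eq = a ∷ D , p , m , cong (a ∷_) eq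

  Diverge : List A → List A → Set
  Diverge [] _ = ⊤
  Diverge (_ ∷ _) [] = ⊤
  Diverge (a ∷ _) (b ∷ _) = a ≢ b

  diverge-irrefl : ∀ (X : List A) {z Y Y′} → ¬ Diverge (X ++ z ∷ Y) (X ++ z ∷ Y′)
  diverge-irrefl [] d = d refl
  diverge-irrefl (x ∷ X) d = d refl

  length-cancel : ∀ (C : List A) {P Q} → length (C ++ P) ≡ length (C ++ Q) → length P ≡ length Q
  length-cancel [] eq = eq
  length-cancel (_ ∷ C) eq = length-cancel C (ℕP.suc-injective eq)

  common-prefix : ((a b : A) → Dec (a ≡ b)) → (P Q : List A) →
    ∃[ C ] ∃[ P′ ] ∃[ Q′ ] (P ≡ C ++ P′ × Q ≡ C ++ Q′ × Diverge P′ Q′)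
  common-prefix _≟_ [] Q = [] , [] , Q , refl , refl , tt
  common-prefix _≟_ (a ∷ P) [] = [] , a ∷ P , [] , refl , refl , tt
  common-prefix _≟_ (a ∷ P) (b ∷ Q) with a ≟ b
  ... | no a≢b = [] , a ∷ P , b ∷ Q , refl , refl , a≢b
  ... | yes refl with common-prefix _≟_ P Q
  ...   | C , P′ , Q′ , eP , eQ , d = a ∷ C , P′ , Q′ , cong (a ∷_) eP , cong (a ∷_) eQ , d

  sum-remove : ∀ (g : A → ℕ) X r Y → sum (map g (X ++ r ∷ Y)) ≡ g r + sum (map g (X ++ Y))
  sum-remove g X r Y = sum-↭ (PermProp.map⁺ g (PermProp.shift r X Y))

  length≤sum : ∀ (g : A → ℕ) (R xs : List A) → Unique R → (∀ {r} → r ∈ R → r ∈ xs) →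
    All (λ r → g r ≡ 1) R → length R ≤ sum (map g xs)
  length≤sum g [] xs _ _ _ = z≤n
  length≤sum g (r ∷ R) xs (r∉R ∷ uR) R⊆xs (gr ∷ gR) with MemP.∈-∃++ (R⊆xs (here refl))
  ... | X , Y , refl =
    subst (suc (length R) ≤_) (sym (trans (sum-remove g X r Y) (cong (_+ sum (map g (X ++ Y))) gr)))
      (s≤s (length≤sum g R (X ++ Y) uR R⊆X++Y gR))
    where
    R⊆X++Y : ∀ {r′} → r′ ∈ R → r′ ∈ X ++ Y
    R⊆X++Y {r′} r′∈R with MemP.∈-++⁻ X (R⊆xs (there r′∈R))
    ... | inj₁ r′∈X = MemP.∈-++⁺ˡ r′∈X
    ... | inj₂ (here r′≡r) = ⊥-elim (All.lookup r∉R r′∈R (sym r′≡r))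
    ... | inj₂ (there r′∈Y) = MemP.∈-++⁺ʳ X r′∈Y

module Tree {n : ℕ} (adj : Fin n → Fin n → Bool) (tree : Graph.IsTree adj) where
  open Graph adj
  open import Data.List.Membership.DecPropositional (FinP._≟_ {n}) using (_∈?_)

  V : Set
  V = Fin n

  edge-sym : ∀ {x y} → Edge x y → Edge y x
  edge-sym {x} {y} e = trans (sym (proj₁ tree x y)) e

  edge-irrefl : ∀ {x y} → Edge x y → x ≢ y
  edge-irrefl {x} e refl with trans (sym e) (proj₁ (proj₂ tree) x)
  ... | ()

  path-exists : ∀ x y → ∃[ vs ] IsPath x y vs
  path-exists = proj₁ (proj₂ (proj₂ tree))

  path-unique : ∀ {x y vs ws} → IsPath x y vs → IsPath x y ws → vs ≡ ws
  path-unique {x} {y} {vs} {ws} = proj₂ (proj₂ (proj₂ tree)) x y vs ws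

  walk-head : ∀ {a b vs} → Walk a b vs → ∃[ R ] (vs ≡ a ∷ R)
  walk-head here = [] , refl
  walk-head (step _ _) = _ , refl

  walk-tail : ∀ {a b d R} → Walk a b (a ∷ d ∷ R) → Edge a d × Walk d b (d ∷ R)
  walk-tail (step e w) with walk-head w
  ... | _ , refl = e , w

  walk-snoc : ∀ {a y x vs} → Walk a y vs → Edge y x → Walk a x (vs ++ [ x ])
  walk-snoc here e = step e here
  walk-snoc (step e′ w) e = step e′ (walk-snoc w e)

  walk-reverse : ∀ {a b vs} → Walk a b vs → Walk b a (reverse vs)
  walk-reverse here = here
  walk-reverse (step {x} {vs = vs} e w) =
    subst (Walk _ _) (sym (ListP.unfold-reverse x vs)) (walk-snoc (walk-reverse w) (edge-sym e))

  walk-split : ∀ (X : List V) {z Y a b} → Walk a b (X ++ z ∷ Y) →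
    Walk a z (X ++ [ z ]) × Walk z b (z ∷ Y)
  walk-split [] here = here , here
  walk-split [] (step e w) = here , step e w
  walk-split (c ∷ []) (step e w) with walk-head w
  ... | _ , refl = step e here , w
  walk-split (c ∷ d ∷ X) (step e w) with walk-split (d ∷ X) w
  ... | w₁ , w₂ = step e w₁ , w₂

  walk-join : ∀ (X : List V) {m Y a b} → Walk a m (X ++ [ m ]) → Walk m b (m ∷ Y) →
    Walk a b (X ++ m ∷ Y)
  walk-join [] here w₂ = w₂
  walk-join [] (step e ()) w₂
  walk-join (c ∷ []) (step e here) w₂ = step e w₂
  walk-join (c ∷ d ∷ X) (step e w₁) w₂ = step e (walk-join (d ∷ X) w₁ w₂)

  walk-end : ∀ {a b a′ b′ vs} → Walk a b vs → Walk a′ b′ vs → b ≡ b′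
  walk-end here here = refl
  walk-end here (step e ())
  walk-end (step e ()) here
  walk-end (step e w) (step e′ w′) = walk-end w w′

  walk-target : ∀ {a b} X {c} → Walk a b (X ++ [ c ]) → b ≡ c
  walk-target X w = walk-end (proj₂ (walk-split X w)) here

  walk⇒path : ∀ {a b vs} → Walk a b vs →
    ∃[ ps ] (IsPath a b ps × (∀ {z} → z ∈ ps → z ∈ vs))
  walk⇒path here = _ , (here , [] ∷ []) , λ m → m
  walk⇒path (step {x} e w) with walk⇒path w
  ... | ps , (w′ , ps-unique) , ps⊆ with x ∈? ps
  ...   | no x∉ps = x ∷ ps , (step e w′ , AllP.¬Any⇒All¬ ps x∉ps ∷ ps-unique) , ⊆x∷
    where
    ⊆x∷ : ∀ {z} → z ∈ x ∷ ps → z ∈ x ∷ _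
    ⊆x∷ (here refl) = here refl
    ⊆x∷ (there z∈ps) = there (ps⊆ z∈ps)
  ...   | yes x∈ps with MemP.∈-∃++ x∈ps
  ...     | X , Y , refl = x ∷ Y , (proj₂ (walk-split X w′) , Unique-suffix X ps-unique) ,
                           λ z∈ → there (ps⊆ (MemP.∈-++⁺ʳ X z∈))

  path-prefix : ∀ (X : List V) {z Y a b} → IsPath a b (X ++ z ∷ Y) → IsPath a z (X ++ [ z ])
  path-prefix X {z} {Y} (w , u) =
    proj₁ (walk-split X w) ,
    proj₁ (Unique-++⁻ (X ++ [ z ]) (subst Unique (sym (ListP.++-assoc X [ z ] Y)) u))

  path-suffix : ∀ (X : List V) {z Y a b} → IsPath a b (X ++ z ∷ Y) → IsPath z b (z ∷ Y)
  path-suffix X (w , u) = proj₂ (walk-split X w) , Unique-suffix X u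

  path-target : ∀ {a b} X {c} → IsPath a b (X ++ [ c ]) → b ≡ c
  path-target X p = walk-target X (proj₁ p)

  path-ends-at : ∀ {a y} P {h B} → length B ≡ 0 → IsPath a y (P ++ h ∷ B) → y ≡ h
  path-ends-at P {B = []} _ p = path-target P p

  -- A path in a tree does not continue past its end vertex (the prefix is already the path).
  path-stops : ∀ (X : List V) {Z a b} → IsPath a b (X ++ b ∷ Z) → Z ≡ []
  path-stops X {Z} {b = b} p =
    ListP.∷-injectiveʳ (ListP.++-cancelˡ X (b ∷ Z) [ b ] (path-unique p (path-prefix X p)))

  dist-unique : ∀ {a b k₁ k₂} → Dist a b k₁ → Dist a b k₂ → k₁ ≡ k₂
  dist-unique (vs , p , l) (ws , q , l′) with path-unique p q
  ... | refl = ℕP.suc-injective (trans (sym l) l′)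

  branches-disjoint : ∀ {r a b} C A′ B′ → IsPath r a (C ++ A′) → IsPath r b (C ++ B′) →
    Diverge A′ B′ → ∀ {z} → z ∈ A′ → z ∈ B′ → ⊥
  branches-disjoint {r} C A′ B′ pa pb d {z} z∈A′ z∈B′ with MemP.∈-∃++ z∈A′ | MemP.∈-∃++ z∈B′
  ... | X , Y , refl | X′ , Y′ , refl =
    diverge-irrefl X (subst (λ X″ → Diverge (X ++ z ∷ Y) (X″ ++ z ∷ Y′)) (sym same-start) d)
    where
    path-to-z : ∀ {c} W Z → IsPath r c (C ++ W ++ z ∷ Z) → IsPath r z ((C ++ W) ++ [ z ])
    path-to-z {c} W Z p =
      path-prefix (C ++ W) (subst (IsPath r c) (sym (ListP.++-assoc C W (z ∷ Z))) p)
    same-start : X ≡ X′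
    same-start = ListP.++-cancelˡ C X X′
      (ListP.∷ʳ-injectiveˡ (C ++ X) (C ++ X′) (path-unique (path-to-z X Y pa) (path-to-z X′ Y′ pb)))

  -- If the paths from r to a and to b share the prefix c ∷ C and then diverge into A′ and B′,
  -- then d(a,b) = |A′| + |B′|: the path climbs A′ back to the branch vertex and descends B′.
  dist-via-branch : ∀ {r a b} (c : V) (C A′ B′ : List V) → IsPath r a ((c ∷ C) ++ A′) →
    IsPath r b ((c ∷ C) ++ B′) → Diverge A′ B′ → Dist a b (length A′ + length B′)
  dist-via-branch c C A′ B′ pa pb d with split-last c C
  ... | C₀ , m , eq = reverse A′ ++ m ∷ B′ , (walk-join (reverse A′) up (proj₁ from-m) , unique) , len
    where
    through-m : ∀ X → (c ∷ C) ++ X ≡ C₀ ++ m ∷ X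
    through-m X = trans (cong (_++ X) eq) (ListP.++-assoc C₀ [ m ] X)
    to-a : IsPath m _ (m ∷ A′)
    to-a = path-suffix C₀ (subst (IsPath _ _) (through-m A′) pa)
    from-m : IsPath m _ (m ∷ B′)
    from-m = path-suffix C₀ (subst (IsPath _ _) (through-m B′) pb)
    up : Walk _ m (reverse A′ ++ [ m ])
    up = subst (Walk _ _) (ListP.unfold-reverse m A′) (walk-reverse (proj₁ to-a))
    disjoint : ∀ {z} → z ∈ reverse A′ → z ∈ m ∷ B′ → ⊥
    disjoint z∈ (here refl) with proj₂ to-a
    ... | m∉A′ ∷ _ = All.lookup m∉A′ (AnyP.reverse⁻ z∈) refl
    disjoint z∈ (there z∈B′) = branches-disjoint (c ∷ C) A′ B′ pa pb d (AnyP.reverse⁻ z∈) z∈B′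
    unique : Unique (reverse A′ ++ m ∷ B′)
    unique = UniqueP.++⁺ (Unique-reverse (Unique-suffix [ m ] (proj₂ to-a))) (proj₂ from-m)
               (λ (z∈ , z∈′) → disjoint z∈ z∈′)
    len : length (reverse A′ ++ m ∷ B′) ≡ suc (length A′ + length B′)
    len = begin
      length (reverse A′ ++ m ∷ B′)   ≡⟨ ListP.length-++ (reverse A′) ⟩
      length (reverse A′) + suc (length B′) ≡⟨ cong (_+ suc (length B′)) (ListP.length-reverse A′) ⟩
      length A′ + suc (length B′)     ≡⟨ ℕP.+-suc (length A′) (length B′) ⟩
      suc (length A′ + length B′)     ∎
      where open ≡-Reasoning

  deg-≥ : ∀ v (R : List V) → Unique R → All (Edge v) R → length R ≤ deg v
  deg-≥ v R uR eR =
    length≤sum (λ u → if adj v u then 1 else 0) R (allFin n) uR (λ {r} _ → MemP.∈-allFin r)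
      (All.map (cong (λ b → if b then 1 else 0)) eR)

  regroup : ∀ {a b} P D p m Z → P ≡ D ++ p ∷ m ∷ [] →
    IsPath a b (P ++ Z) → IsPath a b (D ++ p ∷ m ∷ Z)
  regroup P D p m Z P≡ =
    subst (IsPath _ _) (trans (cong (_++ Z) P≡) (ListP.++-assoc D (p ∷ m ∷ []) Z))

  path-prefix₂ : ∀ D {p m Z a b} → IsPath a b (D ++ p ∷ m ∷ Z) → IsPath a m (D ++ p ∷ m ∷ [])
  path-prefix₂ D {p} {m} {Z} pab = subst (IsPath _ _) (ListP.++-assoc D [ p ] [ m ])
    (path-prefix (D ++ [ p ]) (subst (IsPath _ _) (sym (ListP.++-assoc D [ p ] (m ∷ Z))) pab))

  -- The branch vertex m then has the three distinct neighbours
  -- p, h₁, h₂, so it is a core; and P is the path from r to m.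
  branch-vertex : ∀ {r a b} P D p m {h₁ A h₂ B} → P ≡ D ++ p ∷ m ∷ [] →
    IsPath r a (P ++ h₁ ∷ A) → IsPath r b (P ++ h₂ ∷ B) → h₁ ≢ h₂ → Core m × IsPath r m P
  branch-vertex P D p m {h₁} {h₂ = h₂} P≡ pa pb h₁≢h₂
    with path-suffix D (regroup P D p m _ P≡ pa) | path-suffix D (regroup P D p m _ P≡ pb)
  ... | wa , ((_ ∷ p≢h₁ ∷ _) ∷ _) | wb , ((_ ∷ p≢h₂ ∷ _) ∷ _) =
    deg-≥ m (p ∷ h₁ ∷ h₂ ∷ []) ((p≢h₁ ∷ p≢h₂ ∷ []) ∷ (h₁≢h₂ ∷ []) ∷ [] ∷ [])
      (edge-sym (proj₁ (walk-tail wa)) ∷ proj₁ (walk-tail (proj₂ (walk-tail wa)))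
        ∷ proj₁ (walk-tail (proj₂ (walk-tail wb))) ∷ []) ,
    subst (IsPath _ m) (sym P≡) (path-prefix₂ D (regroup P D p m _ P≡ pa))

  comp-path : ∀ {v u x P} → Edge v u → InComp v u x → IsPath v x P → ∃[ R ] (P ≡ v ∷ u ∷ R)
  comp-path {v} {u} e (vs , w , avoids-v) pP with walk⇒path w
  ... | ps , (w′ , ps-unique) , ps⊆vs with walk-head w′
  ... | R , refl = R , path-unique pP (step e w′ , v∉ ∷ ps-unique)
    where
    v∉ : All (v ≢_) (u ∷ R)
    v∉ = All.tabulate (λ z∈ → ≢-sym (All.lookup avoids-v (ps⊆vs z∈)))

  path-comp : ∀ {v u x R} → IsPath v x (v ∷ u ∷ R) → InComp v u x
  path-comp (w , (v∉ ∷ _)) = _ , proj₂ (walk-tail w) , All.map ≢-sym v∉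

  path-edge : ∀ {v u x R} → IsPath v x (v ∷ u ∷ R) → Edge v u
  path-edge (w , _) = proj₁ (walk-tail w)

  gleg-edge : ∀ {v u} → GLeg v u → Edge v u
  gleg-edge (inj₁ leg) = proj₁ leg
  gleg-edge (inj₂ (_ , mod)) = proj₁ mod

  edge-path : ∀ {v u} → Edge v u → IsPath v u (v ∷ u ∷ [])
  edge-path e = step e here , (edge-irrefl e ∷ []) ∷ [] ∷ []

  comp-self : ∀ {v u} → Edge v u → InComp v u u
  comp-self e = path-comp (edge-path e)

  comp-disjoint : ∀ {v u₁ u₂ t} → Edge v u₁ → Edge v u₂ → InComp v u₁ t → InComp v u₂ t → u₁ ≡ u₂
  comp-disjoint {v} {t = t} e₁ e₂ i₁ i₂ with path-exists v t
  ... | P , pP with comp-path e₁ i₁ pP | comp-path e₂ i₂ pP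
  ... | R₁ , refl | R₂ , eq = ListP.∷-injectiveˡ (ListP.∷-injectiveʳ eq)

  short-or-long : ∀ v u → Edge v u → Short v u ⊎ Long v u
  short-or-long v u e with FinP.any? (λ z → (adj u z BoolP.≟ true) ×-dec (¬? (z FinP.≟ v)))
  ... | yes (z , e′ , z≢v) =
    inj₂ λ short → edge-irrefl e′ (sym (short z (_ , step e′ here , ≢-sym (edge-irrefl e) ∷ z≢v ∷ [])))
  ... | no no-other-neighbour = inj₁ λ x (vs , w , avoids-v) → stuck w avoids-v
    where
    stuck : ∀ {x vs} → Walk u x vs → All (_≢ v) vs → x ≡ u
    stuck here _ = refl
    stuck (step {y = y} e′ w) (_ ∷ avoids-v) = ⊥-elim (no-other-neighbour (y , e′ , first w avoids-v))
      where
      first : ∀ {y x vs} → Walk y x vs → All (_≢ v) vs → y ≢ v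
      first here (p ∷ _) = p
      first (step _ _) (p ∷ _) = p

  separates-sym : ∀ {t x y} → Separates t x y → Separates t y x
  separates-sym (k₁ , k₂ , d₁ , d₂ , k₁≢k₂) = k₂ , k₁ , d₂ , d₁ , ≢-sym k₁≢k₂

  separates-across : ∀ {v t x y uˣ uʸ Rx Ry} → uˣ ≢ uʸ → IsPath v x (v ∷ uˣ ∷ Rx) →
    IsPath v y (v ∷ uʸ ∷ Ry) → length Rx ≡ length Ry → InComp v uˣ t → Separates t x y
  separates-across {v} {t} {uˣ = uˣ} {uʸ} {Rx = Rx} {Ry} uˣ≢uʸ px py same-depth t∈
    with path-exists v t
  ... | Pt , pt with comp-path (path-edge px) t∈ pt
  ... | Rt , refl with common-prefix FinP._≟_ Rx Rt
  ... | C , X′ , T′ , refl , refl , d =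
    length X′ + length T′ , suc (length Ry) + suc (length (C ++ T′)) ,
    dist-via-branch v (uˣ ∷ C) X′ T′ px pt d ,
    dist-via-branch v [] (uʸ ∷ Ry) (uˣ ∷ C ++ T′) py pt (≢-sym uˣ≢uʸ) ,
    ℕP.<⇒≢ closer
    where
    closer : length X′ + length T′ < suc (length Ry) + suc (length (C ++ T′))
    closer = s≤s (ℕP.≤-trans
      (ℕP.+-mono-≤ (subst (length X′ ≤_) same-depth (ListP.length-++-≤ʳ X′ {C}))
                   (ListP.length-++-≤ʳ T′ {C}))
      (ℕP.+-monoʳ-≤ (length Ry) (ℕP.n≤1+n _)))

  -- Two distinct children a, b of the same vertex are separated by every vertex t
  -- below a: d(t,a) = |Z| while d(t,b) = |Z| + 2.
  separates-siblings : ∀ {r a b t} c C Z → IsPath r a ((c ∷ C) ++ [ a ]) →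
    IsPath r b ((c ∷ C) ++ [ b ]) → b ≢ a → IsPath r t ((c ∷ C) ++ a ∷ Z) → Separates t a b
  separates-siblings {r} {a} {b} {t} c C Z pa pb b≢a pt =
    length Z , suc (suc (length Z)) ,
    dist-via-branch c (C ++ [ a ]) [] Z
      (subst (IsPath r a) (sym (ListP.++-identityʳ (c ∷ C ++ [ a ]))) pa)
      (subst (IsPath r t) (cong (c ∷_) (sym (ListP.++-assoc C [ a ] Z))) pt) tt ,
    dist-via-branch c C [ b ] (a ∷ Z) pb pt b≢a ,
    ℕP.<⇒≢ (ℕP.m<n+m (length Z) {2} (s≤s z≤n))

  module ModifiedLeg {v u w C D p} (core-v : Core v) (mod : ModLegAt v u w)
                     (to-w : IsPath v w (v ∷ u ∷ C)) (last-edge : v ∷ u ∷ C ≡ D ++ p ∷ w ∷ []) where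

    w-only-core : ∀ z → InComp v u z → Core z → z ≡ w
    w-only-core = proj₂ (proj₂ (proj₂ mod))

    deg-w : deg w ≡ 3
    deg-w = proj₁ (proj₁ (proj₂ (proj₂ mod)))

    depth-w : Dist v w (suc (length C))
    depth-w = _ , to-w , refl

    -- A vertex of the leg deeper than w lies below w: otherwise the paths to it and to w
    -- would branch at a second core of the leg.
    below-core : ∀ {z Rz} → IsPath v z (v ∷ u ∷ Rz) → length C < length Rz →
      ∃[ z′ ] ∃[ Z ] (Rz ≡ C ++ z′ ∷ Z)
    below-core {z} {Rz} pz deeper with common-prefix FinP._≟_ Rz C
    ... | C₂ , [] , E , refl , C≡ , _ = ⊥-elim (ℕP.<⇒≱ deeper shallower)
      where
      shallower : length (C₂ ++ []) ≤ length C
      shallower = subst (_≤ length C) (cong length (sym (ListP.++-identityʳ C₂)))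
        (subst (length C₂ ≤_) (cong length (sym C≡)) (ListP.length-++-≤ˡ C₂))
    ... | C₂ , z′ ∷ Z , [] , refl , C≡ , _ =
      z′ , Z , cong (_++ z′ ∷ Z) (sym (trans C≡ (ListP.++-identityʳ C₂)))
    ... | C₂ , z′ ∷ Z , e ∷ E , refl , refl , z′≢e = ⊥-elim (second-core (split-last₂ v u C₂))
      where
      second-core : ¬ (∃[ D₂ ] ∃[ p₂ ] ∃[ m₂ ] (v ∷ u ∷ C₂ ≡ D₂ ++ p₂ ∷ m₂ ∷ []))
      second-core (D₂ , p₂ , m₂ , ends-m₂) = m₂≢w (w-only-core m₂ (path-comp to-m₂) core-m₂)
        where
        core-m₂ : Core m₂
        core-m₂ = proj₁ (branch-vertex (v ∷ u ∷ C₂) D₂ p₂ m₂ ends-m₂ pz to-w z′≢e)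
        to-m₂ : IsPath v m₂ (v ∷ u ∷ C₂)
        to-m₂ = proj₂ (branch-vertex (v ∷ u ∷ C₂) D₂ p₂ m₂ ends-m₂ pz to-w z′≢e)
        -- w cannot be m₂, since the path to w continues past m₂.
        m₂≢w : m₂ ≢ w
        m₂≢w refl with ListP.++-cancelˡ C₂ (e ∷ E) []
          (trans (ListP.∷-injectiveʳ (ListP.∷-injectiveʳ (path-unique to-w to-m₂)))
                 (sym (ListP.++-identityʳ C₂)))
        ... | ()

    descendant : ∀ {z k} → InComp v u z → Dist v z k → suc (suc (length C)) ≤ k →
      ∃[ z′ ] ∃[ Z ] (IsPath v z ((v ∷ u ∷ C) ++ z′ ∷ Z) × k ≡ suc (suc (length C + length Z)))
    descendant z∈ (P , pz , len) deep with comp-path (proj₁ mod) z∈ pz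
    ... | Rz , refl with below-core pz (ℕP.≤-pred (subst (_ ≤_) (sym (ℕP.suc-injective len)) deep))
    ...   | z′ , Z , refl = z′ , Z , pz ,
      trans (sym (ℕP.suc-injective len))
            (cong suc (trans (ListP.length-++ C) (ℕP.+-suc (length C) (length Z))))

    child : ∀ {b h Z} → IsPath v b ((v ∷ u ∷ C) ++ h ∷ Z) → Edge w h × p ≢ h
    child pb with path-suffix D (regroup _ D p w _ last-edge pb)
    ... | wk , ((_ ∷ p≢h ∷ _) ∷ _) = proj₁ (walk-tail (proj₂ (walk-tail wk))) , p≢h

    to-pw : IsPath v w (D ++ p ∷ w ∷ [])
    to-pw = subst (IsPath v w) last-edge to-w

    edge-wp : Edge w p
    edge-wp = edge-sym (proj₁ (walk-tail (proj₁ (path-suffix D to-pw))))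

    -- The parent p of w is not a leg of w, since its side of T - w contains the core v.
    parent-not-leg : ¬ Leg w p
    parent-not-leg leg = ℕP.<⇒≱ (proj₂ leg v (_ , walk-reverse (proj₁ to-p) , All.tabulate w∉)) core-v
      where
      to-p : IsPath v p (D ++ [ p ])
      to-p = path-prefix D to-pw
      w∉ : ∀ {z} → z ∈ reverse (D ++ [ p ]) → z ≢ w
      w∉ z∈ refl = proj₂ (proj₂ (Unique-++⁻ (D ++ [ p ])
          (subst Unique (sym (ListP.++-assoc D [ p ] [ w ])) (proj₂ to-pw))))
        (AnyP.reverse⁻ z∈) (here refl)

    ends-at-short-child : ∀ {a h A} → Short w h → IsPath v a ((v ∷ u ∷ C) ++ h ∷ A) → A ≡ [] × a ≡ h
    ends-at-short-child {a} {h} {A} short pa =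
      path-stops (v ∷ u ∷ C) (subst (λ q → IsPath v q ((v ∷ u ∷ C) ++ h ∷ A)) a≡h pa) , a≡h
      where
      a≡h : a ≡ h
      a≡h = short a (path-comp (path-suffix [ p ] (path-suffix D (regroup _ D p w _ last-edge pa))))

    module Children {h₁ h₂} (to-h₁ : IsPath v h₁ ((v ∷ u ∷ C) ++ [ h₁ ]))
                            (to-h₂ : IsPath v h₂ ((v ∷ u ∷ C) ++ [ h₂ ])) (h₁≢h₂ : h₁ ≢ h₂) where

      -- w has degree 3 and the neighbours p, h₁, h₂, so these are all of them.
      only-children : ∀ {z} → Edge w z → z ≢ p → z ≡ h₁ ⊎ z ≡ h₂
      only-children {z} e z≢p with z FinP.≟ h₁ | z FinP.≟ h₂
      ... | yes z≡h₁ | _ = inj₁ z≡h₁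
      ... | no _ | yes z≡h₂ = inj₂ z≡h₂
      ... | no z≢h₁ | no z≢h₂ = ⊥-elim (ℕP.<-irrefl refl (subst (4 ≤_) deg-w four-neighbours))
        where
        four-neighbours : 4 ≤ deg w
        four-neighbours = deg-≥ w (p ∷ h₁ ∷ h₂ ∷ z ∷ [])
          ((proj₂ (child to-h₁) ∷ proj₂ (child to-h₂) ∷ ≢-sym z≢p ∷ [])
            ∷ (h₁≢h₂ ∷ ≢-sym z≢h₁ ∷ []) ∷ (≢-sym z≢h₂ ∷ []) ∷ [] ∷ [])
          (edge-wp ∷ proj₁ (child to-h₁) ∷ proj₁ (child to-h₂) ∷ e ∷ [])

      child-is : ∀ {b z Z} → IsPath v b ((v ∷ u ∷ C) ++ z ∷ Z) → z ≡ h₁ ⊎ z ≡ h₂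
      child-is pb = only-children (proj₁ (child pb)) (≢-sym (proj₂ (child pb)))

      short-leg-is-child : ∀ {h} → Leg w h → Short w h → Short w h₁ ⊎ Short w h₂
      short-leg-is-child leg short
        with only-children (proj₁ leg) (λ h≡p → parent-not-leg (subst (Leg w) h≡p leg))
      ... | inj₁ refl = inj₁ short
      ... | inj₂ refl = inj₂ short

      short-child : Short w h₁ ⊎ Short w h₂
      short-child with proj₂ (proj₁ (proj₂ (proj₂ mod)))
      ... | _ , _ , _ , leg₁ , _ , inj₁ short = short-leg-is-child leg₁ short
      ... | _ , _ , _ , _ , leg₂ , inj₂ short = short-leg-is-child leg₂ short

      -- Vertices x, y at equal depth below h₁ and h₂ are h₁ and h₂ themselves,
      -- since one of these children is a short leg of w.
      are-children : ∀ {x y A B} → IsPath v x ((v ∷ u ∷ C) ++ h₁ ∷ A) →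
        IsPath v y ((v ∷ u ∷ C) ++ h₂ ∷ B) → length A ≡ length B → x ≡ h₁ × y ≡ h₂
      are-children px py same with short-child
      ... | inj₁ short with ends-at-short-child short px
      ...   | A≡[] , x≡h₁ = x≡h₁ , path-ends-at (v ∷ u ∷ C) (trans (sym same) (cong length A≡[])) py
      are-children px py same | inj₂ short with ends-at-short-child short py
      ...   | B≡[] , y≡h₂ = path-ends-at (v ∷ u ∷ C) (trans same (cong length B≡[])) px , y≡h₂

      next-level : ∀ {z i} → InComp v u z → Dist v w i → Dist v z (suc i) → z ≡ h₁ ⊎ z ≡ h₂
      next-level z∈ dw dz with dist-unique dw depth-w
      ... | refl with descendant z∈ dz ℕP.≤-refl
      ...   | z′ , [] , pz , _ rewrite path-target (v ∷ u ∷ C) pz = child-is pz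
      ...   | z′ , _ ∷ Z , _ , depth =
        ⊥-elim (ℕP.m≢1+m+n (length C) (trans deeper (ℕP.+-suc (length C) (length Z))))
        where
        deeper : length C ≡ length C + suc (length Z)
        deeper = ℕP.suc-injective (ℕP.suc-injective depth)

      -- Every vertex of the leg at depth ≥ d(v,w) + 2 lies below h₁ or h₂, hence separates them.
      deep-separates : ∀ {i t k} → Dist v w i → InComp v u t → Dist v t k → suc (suc i) ≤ k →
        Separates t h₁ h₂
      deep-separates dw t∈ dt deep with dist-unique dw depth-w
      ... | refl with descendant t∈ dt (ℕP.≤-trans (ℕP.n≤1+n _) deep)
      ...   | z′ , Z , pt , _ with child-is pt
      ...     | inj₁ refl = separates-siblings v (u ∷ C) Z to-h₁ to-h₂ (≢-sym h₁≢h₂) pt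
      ...     | inj₂ refl = separates-sym (separates-siblings v (u ∷ C) Z to-h₂ to-h₁ h₁≢h₂ pt)

  module Separators (L : V → Set) {v} (core-v : Core v)
                    (local : LocalSet v (λ x → L x × OnGLeg v x)) where
    open Types v (λ x → L x × OnGLeg v x)

    one-empty-leg : ∀ u₁ u₂ → Leg v u₁ → Leg v u₂ → TypeS0 u₁ → TypeS0 u₂ → u₁ ≡ u₂
    one-empty-leg = proj₁ (proj₂ local)

    standard-type : ∀ u → Leg v u → TypeS0 u ⊎ TypeS1 u ⊎ TypeS2 u ⊎ TypeS3 u
    standard-type = proj₁ (proj₂ (proj₂ local))

    modified-type : ∀ u w → ModLegAt v u w → TypeM1 u w ⊎ TypeM2 u w ⊎ TypeM3 u w
    modified-type = proj₁ (proj₂ (proj₂ (proj₂ local)))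

    empty-leg-no-m1 : (∃[ u ] (Leg v u × TypeS0 u)) → ∀ u w → ModLegAt v u w → ¬ TypeM1 u w
    empty-leg-no-m1 = proj₁ (proj₂ (proj₂ (proj₂ (proj₂ local))))

    empty-long-leg : ∀ u → Leg v u → Long v u → TypeS0 u →
      ∀ u′ → Leg v u′ → Long v u′ → u′ ≢ u → TypeS2 u′
    empty-long-leg = proj₁ (proj₂ (proj₂ (proj₂ (proj₂ (proj₂ local)))))

    empty-short-leg : ∀ u → Leg v u → Short v u → TypeS0 u →
      ∀ u′ → Leg v u′ → Long v u′ → TypeS2 u′ ⊎ TypeS3 u′
    empty-short-leg = proj₂ (proj₂ (proj₂ (proj₂ (proj₂ (proj₂ local)))))

    TwoSeparators : V → V → Set
    TwoSeparators x y = ∃[ t₁ ] ∃[ t₂ ] (t₁ ≢ t₂ × L t₁ × L t₂ × Separates t₁ x y × Separates t₂ x y)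

    OneIn : V → Set
    OneIn u = ∃[ t ] (InComp v u t × L t)

    m2-two : ∀ {u w} → TypeM2 u w → TwoIn u
    m2-two (_ , _ , _ , t₁ , t₂ , t₁≢t₂ , t₁∈ , t₂∈ , S₁ , S₂ , _) =
      t₁ , t₂ , t₁≢t₂ , t₁∈ , t₂∈ , S₁ , S₂

    classify : ∀ {u} → GLeg v u → TwoIn u ⊎ OneIn u ⊎ (Leg v u × TypeS0 u)
    classify {u} (inj₁ leg) with standard-type u leg
    ... | inj₁ s0 = inj₂ (inj₂ (leg , s0))
    ... | inj₂ (inj₁ (t , t∈ , St , _)) = inj₂ (inj₁ (t , t∈ , proj₁ St))
    ... | inj₂ (inj₂ (inj₁ two)) = inj₁ two
    ... | inj₂ (inj₂ (inj₂ (Su , _))) = inj₂ (inj₁ (u , comp-self (proj₁ leg) , proj₁ Su))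
    classify {u} (inj₂ (w , mod)) with modified-type u w mod
    ... | inj₁ (t , t∈ , _ , St , _) = inj₂ (inj₁ (t , t∈ , proj₁ St))
    ... | inj₂ (inj₁ m2) = inj₁ (m2-two m2)
    ... | inj₂ (inj₂ (two , _)) = inj₁ two

    module Across {x y uˣ uʸ Rx Ry} (uˣ≢uʸ : uˣ ≢ uʸ) (px : IsPath v x (v ∷ uˣ ∷ Rx))
                  (py : IsPath v y (v ∷ uʸ ∷ Ry)) (same-depth : length Rx ≡ length Ry) where

      separates-from-x : ∀ {t} → InComp v uˣ t → Separates t x y
      separates-from-x = separates-across uˣ≢uʸ px py same-depth

      separates-from-y : ∀ {t} → InComp v uʸ t → Separates t x y
      separates-from-y t∈ =
        separates-sym (separates-across (≢-sym uˣ≢uʸ) py px (sym same-depth) t∈)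

      two-on-x : TwoIn uˣ → TwoSeparators x y
      two-on-x (t₁ , t₂ , t₁≢t₂ , t₁∈ , t₂∈ , S₁ , S₂) =
        t₁ , t₂ , t₁≢t₂ , proj₁ S₁ , proj₁ S₂ , separates-from-x t₁∈ , separates-from-x t₂∈

      two-on-y : TwoIn uʸ → TwoSeparators x y
      two-on-y (t₁ , t₂ , t₁≢t₂ , t₁∈ , t₂∈ , S₁ , S₂) =
        t₁ , t₂ , t₁≢t₂ , proj₁ S₁ , proj₁ S₂ , separates-from-y t₁∈ , separates-from-y t₂∈

      -- One L-vertex on each leg; they differ as the components of uˣ and uʸ are disjoint.
      one-on-each : OneIn uˣ → OneIn uʸ → TwoSeparators x y
      one-on-each (t₁ , t₁∈ , L₁) (t₂ , t₂∈ , L₂) =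
        t₁ , t₂ , t₁≢t₂ , L₁ , L₂ , separates-from-x t₁∈ , separates-from-y t₂∈
        where
        t₁≢t₂ : t₁ ≢ t₂
        t₁≢t₂ refl = uˣ≢uʸ (comp-disjoint (path-edge px) (path-edge py) t₁∈ t₂∈)

      -- If x lies on a short leg, then x and y have depth 1, so y is the neighbour uʸ.
      short-x⇒y≡uʸ : Short v uˣ → y ≡ uʸ
      short-x⇒y≡uʸ short = path-ends-at [ v ] (trans (sym same-depth) (cong length Rx≡[])) py
        where
        Rx≡[] : Rx ≡ []
        Rx≡[] = path-stops [ v ] (subst (λ q → IsPath v q (v ∷ uˣ ∷ Rx)) (short x (path-comp px)) px)

      -- A short leg of y would give y ∈ L or an L-vertex at position ≥ 2 on it; so y's leg is
      -- long and conditions (4), (5) give it type (s,2), the alternative (s,3) putting y in L.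
      opposite-s1-s3 : Leg v uˣ → TypeS0 uˣ → Leg v uʸ → ¬ L y → TypeS1 uʸ ⊎ TypeS3 uʸ → TwoIn uʸ
      opposite-s1-s3 legˣ s0 legʸ ¬Ly s13 with short-or-long v uʸ (proj₁ legʸ)
      ... | inj₁ shortʸ = ⊥-elim (impossible s13)
        where
        impossible : ¬ (TypeS1 uʸ ⊎ TypeS3 uʸ)
        impossible (inj₂ (Su , _)) = ¬Ly (subst L (sym (shortʸ y (path-comp py))) (proj₁ Su))
        impossible (inj₁ (z , z∈ , _ , (k , dz , 2≤k) , _)) = ℕP.<-irrefl refl (subst (2 ≤_) k≡1 2≤k)
          where
          k≡1 : k ≡ 1
          k≡1 = dist-unique (subst (λ q → Dist v q k) (shortʸ z z∈) dz)
                            (_ , edge-path (proj₁ legʸ) , refl)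
      ... | inj₂ longʸ with short-or-long v uˣ (proj₁ legˣ)
      ...   | inj₂ longˣ = empty-long-leg uˣ legˣ longˣ s0 uʸ legʸ longʸ (≢-sym uˣ≢uʸ)
      ...   | inj₁ shortˣ with empty-short-leg uˣ legˣ shortˣ s0 uʸ legʸ longʸ
      ...     | inj₁ two = two
      ...     | inj₂ (Su , _) = ⊥-elim (¬Ly (subst L (sym (short-x⇒y≡uʸ shortˣ)) (proj₁ Su)))

      opposite-empty-leg : Leg v uˣ → TypeS0 uˣ → GLeg v uʸ → ¬ L y → TwoIn uʸ
      opposite-empty-leg legˣ s0 (inj₂ (w , mod)) ¬Ly with modified-type uʸ w mod
      ... | inj₁ m1 = ⊥-elim (empty-leg-no-m1 (uˣ , legˣ , s0) uʸ w mod m1)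
      ... | inj₂ (inj₁ m2) = m2-two m2
      ... | inj₂ (inj₂ (two , _)) = two
      opposite-empty-leg legˣ s0 (inj₁ legʸ) ¬Ly with standard-type uʸ legʸ
      ... | inj₁ s0ʸ = ⊥-elim (uˣ≢uʸ (one-empty-leg uˣ uʸ legˣ legʸ s0 s0ʸ))
      ... | inj₂ (inj₁ s1) = opposite-s1-s3 legˣ s0 legʸ ¬Ly (inj₁ s1)
      ... | inj₂ (inj₂ (inj₁ two)) = two
      ... | inj₂ (inj₂ (inj₂ s3)) = opposite-s1-s3 legˣ s0 legʸ ¬Ly (inj₂ s3)

    across-legs : ∀ {x y uˣ uʸ Rx Ry} → uˣ ≢ uʸ → IsPath v x (v ∷ uˣ ∷ Rx) →
      IsPath v y (v ∷ uʸ ∷ Ry) → length Rx ≡ length Ry →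
      GLeg v uˣ → GLeg v uʸ → ¬ L x → ¬ L y → TwoSeparators x y
    across-legs {x} {y} {uˣ} {uʸ} uˣ≢uʸ px py same-depth gˣ gʸ ¬Lx ¬Ly =
      by-content (classify gˣ) (classify gʸ)
      where
      open Across uˣ≢uʸ px py same-depth
      module Swapped = Across (≢-sym uˣ≢uʸ) py px (sym same-depth)
      by-content : TwoIn uˣ ⊎ OneIn uˣ ⊎ (Leg v uˣ × TypeS0 uˣ) →
                   TwoIn uʸ ⊎ OneIn uʸ ⊎ (Leg v uʸ × TypeS0 uʸ) → TwoSeparators x y
      by-content (inj₁ two) _ = two-on-x two
      by-content (inj₂ _) (inj₁ two) = two-on-y two
      by-content (inj₂ (inj₁ oneˣ)) (inj₂ (inj₁ oneʸ)) = one-on-each oneˣ oneʸ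
      by-content (inj₂ (inj₂ (legˣ , s0))) (inj₂ _) = two-on-y (opposite-empty-leg legˣ s0 gʸ ¬Ly)
      by-content (inj₂ (inj₁ _)) (inj₂ (inj₂ (legʸ , s0))) =
        two-on-x (Swapped.opposite-empty-leg legʸ s0 gˣ ¬Lx)

    -- Then the leg has
    -- neither type (m,1) nor (m,3), whose L-vertex at depth d(v,w)+1 would be h₁ or h₂; so it
    -- has type (m,2), and its two L-vertices at depth ≥ d(v,w)+2 separate h₁ and h₂.
    children-separated : ∀ {u w C D p h₁ h₂} → ModLegAt v u w → IsPath v w (v ∷ u ∷ C) →
      v ∷ u ∷ C ≡ D ++ p ∷ w ∷ [] → IsPath v h₁ ((v ∷ u ∷ C) ++ [ h₁ ]) →
      IsPath v h₂ ((v ∷ u ∷ C) ++ [ h₂ ]) → h₁ ≢ h₂ → ¬ L h₁ → ¬ L h₂ → TwoSeparators h₁ h₂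
    children-separated {u} {w} {h₁ = h₁} {h₂} mod to-w last-edge to-h₁ to-h₂ h₁≢h₂ ¬L₁ ¬L₂ =
      by-type (modified-type u w mod)
      where
      open ModifiedLeg core-v mod to-w last-edge
      open Children to-h₁ to-h₂ h₁≢h₂
      next-level-free : ∀ {z} → InComp v u z → AB w z → ¬ (L z × OnGLeg v z)
      next-level-free z∈ (_ , dw , dz) (Lz , _) with next-level z∈ dw dz
      ... | inj₁ refl = ¬L₁ Lz
      ... | inj₂ refl = ¬L₂ Lz
      by-type : TypeM1 u w ⊎ TypeM2 u w ⊎ TypeM3 u w → TwoSeparators h₁ h₂
      by-type (inj₁ (z , z∈ , ab , Sz , _)) = ⊥-elim (next-level-free z∈ ab Sz)
      by-type (inj₂ (inj₂ (_ , z , z∈ , ab , Sz))) = ⊥-elim (next-level-free z∈ ab Sz)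
      by-type (inj₂ (inj₁ (_ , _ , dw , t₁ , t₂ , t₁≢t₂ , t₁∈ , t₂∈ , S₁ , S₂ ,
                           (_ , d₁ , deep₁) , (_ , d₂ , deep₂)))) =
        t₁ , t₂ , t₁≢t₂ , proj₁ S₁ , proj₁ S₂ ,
        deep-separates dw t₁∈ d₁ deep₁ , deep-separates dw t₂∈ d₂ deep₂

    -- x ≠ y ∉ L at the same depth on the same g-leg: their paths branch at a core m of the
    -- leg, so the leg is a modified leg with small core m, and x, y are its two children.
    within-leg : ∀ {x y u Rx Ry} → x ≢ y → IsPath v x (v ∷ u ∷ Rx) → IsPath v y (v ∷ u ∷ Ry) →
      length Rx ≡ length Ry → GLeg v u → ¬ L x → ¬ L y → TwoSeparators x y
    within-leg {Rx = Rx} {Ry} x≢y px py same-depth g ¬Lx ¬Ly with common-prefix FinP._≟_ Rx Ry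
    ... | C , [] , [] , refl , refl , _ = ⊥-elim (x≢y (walk-end (proj₁ px) (proj₁ py)))
    ... | C , [] , _ ∷ _ , refl , refl , _ with length-cancel C same-depth
    ...   | ()
    within-leg x≢y px py same-depth g ¬Lx ¬Ly | C , _ ∷ _ , [] , refl , refl , _
      with length-cancel C same-depth
    ...   | ()
    within-leg {x} {y} {u} x≢y px py same-depth g ¬Lx ¬Ly | C , h₁ ∷ A , h₂ ∷ B , refl , refl , h₁≢h₂ =
      at-branch (split-last₂ v u C)
      where
      to-h₁ : IsPath v h₁ ((v ∷ u ∷ C) ++ [ h₁ ])
      to-h₁ = path-prefix (v ∷ u ∷ C) px
      to-h₂ : IsPath v h₂ ((v ∷ u ∷ C) ++ [ h₂ ])
      to-h₂ = path-prefix (v ∷ u ∷ C) py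
      at-branch : (∃[ D ] ∃[ p ] ∃[ m ] (v ∷ u ∷ C ≡ D ++ p ∷ m ∷ [])) → TwoSeparators x y
      at-branch (D , p , m , last-edge) = on-leg g
        where
        core-m : Core m
        core-m = proj₁ (branch-vertex (v ∷ u ∷ C) D p m last-edge px py h₁≢h₂)
        to-m : IsPath v m (v ∷ u ∷ C)
        to-m = proj₂ (branch-vertex (v ∷ u ∷ C) D p m last-edge px py h₁≢h₂)
        on-leg : GLeg v u → TwoSeparators x y
        on-leg (inj₁ leg) = ⊥-elim (ℕP.<⇒≱ (proj₂ leg m (path-comp to-m)) core-m)
        on-leg (inj₂ (w , mod)) with proj₂ (proj₂ (proj₂ mod)) m (path-comp to-m) core-m
        ... | refl with ModifiedLeg.Children.are-children core-v mod to-m last-edge to-h₁ to-h₂ h₁≢h₂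
                          px py (ℕP.suc-injective (length-cancel C same-depth))
        ...   | refl , refl = children-separated mod to-m last-edge to-h₁ to-h₂ h₁≢h₂ ¬Lx ¬Ly

lemma3 : (n : ℕ) (adj : Fin n → Fin n → Bool) → Graph.IsTree adj →
    (L : Fin n → Set) →
    (∀ v → Graph.Core adj v → Graph.LocalSet adj v (λ x → L x × Graph.OnGLeg adj v x)) →
    ∀ v → Graph.Core adj v → ∀ x y → x ≢ y → ¬ L x → ¬ L y →
    Graph.OnGLeg adj v x → Graph.OnGLeg adj v y →
    (∃[ k ] (Graph.Dist adj v x k × Graph.Dist adj v y k)) →
    ∃[ t₁ ] ∃[ t₂ ] (t₁ ≢ t₂ × L t₁ × L t₂
    × Graph.Separates adj t₁ x y × Graph.Separates adj t₂ x y)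
lemma3 n adj tree L local v core-v x y x≢y ¬Lx ¬Ly (uˣ , gˣ , x∈) (uʸ , gʸ , y∈)
       (k , (Px , px , lx) , (Py , py , ly)) =
  by-legs (comp-path (gleg-edge gˣ) x∈ px) (comp-path (gleg-edge gʸ) y∈ py)
  where
  open Tree adj tree
  open Separators L core-v (local v core-v)
  same-depth : ∀ {Rx Ry} → length (v ∷ uˣ ∷ Rx) ≡ suc k → length (v ∷ uʸ ∷ Ry) ≡ suc k →
    length Rx ≡ length Ry
  same-depth lx ly = ℕP.suc-injective (ℕP.suc-injective (trans lx (sym ly)))
  by-legs : ∃[ Rx ] (Px ≡ v ∷ uˣ ∷ Rx) → ∃[ Ry ] (Py ≡ v ∷ uʸ ∷ Ry) → TwoSeparators x y
  by-legs (Rx , refl) (Ry , refl) with uˣ FinP.≟ uʸ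
  ... | yes refl = within-leg x≢y px py (same-depth {Rx} {Ry} lx ly) gˣ ¬Lx ¬Ly
  ... | no uˣ≢uʸ = across-legs uˣ≢uʸ px py (same-depth {Rx} {Ry} lx ly) gˣ gʸ ¬Lx ¬Ly
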